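{- For $i=1,2$ let $\mathcal{A}_i$ be a structure interpreted in a structure $\mathcal{B}_i$; write $f:\mathcal{A}_1\rightsquigarrow\mathcal{B}_1$ and $\alpha:\mathcal{A}_2\rightsquigarrow\mathcal{B}_2$ for the interpretations, and suppose $f$ can be completed to a bi-interpretation $(f,g)$ of $\mathcal{A}_1$ with $\mathcal{B}_1$. Suppose $\mathrm{Th}(\mathcal{B}_1)=\mathrm{Th}(\mathcal{B}_2)$ and this theory $T_B$ is self-recollecting. Let $\sigma:\mathcal{A}_1\to\mathcal{A}_2$ be an isomorphism of structures. Then there exist an isomorphism $\sigma':\mathcal{B}_1\to\mathcal{B}_2$ and a $\mathcal{B}_2$-definable isomorphism $\theta$ from $\sigma'(f(\mathcal{A}_1))$ (the copy of $\mathcal{A}_1$ in $\mathcal{B}_2$ obtained by transporting $f(\mathcal{A}_1)$ via $\sigma'$) onto $\alpha(\mathcal{A}_2)$ such that $\alpha\circ\sigma=\theta\circ\sigma'\circ f$, i.e. viewing $\mathcal{A}_1$ in $\mathcal{B}_1$ via $f$ and $\mathcal{A}_2$ in $\mathcal{B}_2$ via $\alpha$, $\sigma=\theta\circ(\sigma'|_{\mathcal{A}_1})$. The same conclusion holds if $T_B$ is only self-recollecting for definitions, provided the given interpretations (including $f$, $g$ and $\alpha$) are definitions.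
   Context: An interpretation of a structure $\mathcal{A}$ in $\mathcal{B}$ is a bijection from the universe of $\mathcal{A}$ to a $\mathcal{B}$-definable set modulo a $\mathcal{B}$-definable equivalence relation (with parameters) such that images of $\mathcal{A}$-definable sets are $\mathcal{B}$-definable; a definition is an interpretation involving no non-trivial quotient. Interpretations compose. A pair of interpretations $f$ of $\mathcal{A}$ in $\mathcal{B}$ and $g$ of $\mathcal{B}$ in $\mathcal{A}$ is a bi-interpretation if $g\circ f$ is a definable map in $\mathcal{A}$ and $f\circ g$ is a definable map in $\mathcal{B}$ (appropriately composed). A theory $T$ is self-recollecting if whenever $\mathcal{B}'\models T$ is interpreted in $\mathcal{B}\models T$, then $\mathcal{B}'$ is $\mathcal{B}$-definably isomorphic to $\mathcal{B}$; $T$ is self-recollecting for definitions if this holds for interpretations which are definitions. -}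

module Defs where

open import Data.Nat using (ℕ; zero; suc; _+_; _*_)
open import Data.Fin using (Fin)
open import Data.Vec using (Vec; []; _∷_; _++_; concat; lookup; head; map)
open import Data.Vec.Relation.Binary.Pointwise.Inductive using (Pointwise)
open import Data.Product using (Σ; _×_; _,_)
open import Data.Sum using (_⊎_)
open import Data.Empty using (⊥)
open import Relation.Binary.PropositionalEquality using (_≡_)

record Language : Set₁ where
  field
    Func : ℕ → Set
    Rel  : ℕ → Set
open Language public

record Structure (L : Language) : Set₁ where
  field
    Carrier : Set
    funᴹ    : ∀ {n} → Func L n → Vec Carrier n → Carrier
    relᴹ    : ∀ {n} → Rel L n → Vec Carrier n → Set
open Structure public

data Term (L : Language) (n : ℕ) : Set where
  var : Fin n → Term L n
  app : ∀ {k} → Func L k → Vec (Term L n) k → Term L n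

data Formula (L : Language) : ℕ → Set where
  ⊥ᶠ   : ∀ {n} → Formula L n
  _≐_  : ∀ {n} → Term L n → Term L n → Formula L n
  rel  : ∀ {n k} → Rel L k → Vec (Term L n) k → Formula L n
  _∧ᶠ_ : ∀ {n} → Formula L n → Formula L n → Formula L n
  _∨ᶠ_ : ∀ {n} → Formula L n → Formula L n → Formula L n
  _⇒ᶠ_ : ∀ {n} → Formula L n → Formula L n → Formula L n
  ∃ᶠ   : ∀ {n} → Formula L (suc n) → Formula L n
  ∀ᶠ   : ∀ {n} → Formula L (suc n) → Formula L n

module _ {L : Language} (M : Structure L) where
  mutual
    evalT : ∀ {n} → Term L n → Vec (Carrier M) n → Carrier M
    evalT (var i)    ρ = lookup ρ i
    evalT (app F ts) ρ = funᴹ M F (evalTs ts ρ)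

    evalTs : ∀ {n k} → Vec (Term L n) k → Vec (Carrier M) n → Vec (Carrier M) k
    evalTs []       ρ = []
    evalTs (t ∷ ts) ρ = evalT t ρ ∷ evalTs ts ρ

  -- Tarskian satisfaction, variable 0 = most recently bound
  Sat : ∀ {n} → Formula L n → Vec (Carrier M) n → Set
  Sat ⊥ᶠ        ρ = ⊥
  Sat (s ≐ t)   ρ = evalT s ρ ≡ evalT t ρ
  Sat (rel R ts) ρ = relᴹ M R (evalTs ts ρ)
  Sat (φ ∧ᶠ ψ)  ρ = Sat φ ρ × Sat ψ ρ
  Sat (φ ∨ᶠ ψ)  ρ = Sat φ ρ ⊎ Sat ψ ρ
  Sat (φ ⇒ᶠ ψ)  ρ = Sat φ ρ → Sat ψ ρ
  Sat (∃ᶠ φ)    ρ = Σ (Carrier M) λ a → Sat φ (a ∷ ρ)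
  Sat (∀ᶠ φ)    ρ = (a : Carrier M) → Sat φ (a ∷ ρ)

  Definable : ∀ {n} → (Vec (Carrier M) n → Set) → Set
  Definable {n} X =
    Σ ℕ λ m → Σ (Formula L (n + m)) λ φ → Σ (Vec (Carrier M) m) λ b →
      ∀ x → (X x → Sat φ (x ++ b)) × (Sat φ (x ++ b) → X x)

  Definable₂ : ∀ {n m} → (Vec (Carrier M) n → Vec (Carrier M) m → Set) → Set
  Definable₂ {n} {m} R =
    Definable {n + m} (λ z → Σ (Vec (Carrier M) n) λ x → Σ (Vec (Carrier M) m) λ y →
      (z ≡ x ++ y) × R x y)

  -- the graph {(a, z) | R z a} of a map into a copy in M (given by
  -- a representation relation R) is definable
  GraphDefinable : ∀ {k} → (Vec (Carrier M) k → Carrier M → Set) → Set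
  GraphDefinable R = Definable₂ {1} (λ u z → R z (head u))

record Iso {L : Language} (M N : Structure L) : Set where
  field
    to       : Carrier M → Carrier N
    from     : Carrier N → Carrier M
    from∘to  : ∀ x → from (to x) ≡ x
    to∘from  : ∀ y → to (from y) ≡ y
    fun-pres : ∀ {n} (F : Func L n) (xs : Vec (Carrier M) n) →
               to (funᴹ M F xs) ≡ funᴹ N F (map to xs)
    rel-pres : ∀ {n} (R : Rel L n) (xs : Vec (Carrier M) n) →
               (relᴹ M R xs → relᴹ N R (map to xs)) × (relᴹ N R (map to xs) → relᴹ M R xs)
open Iso public

-- An interpretation of A in B is given by a relation
-- Rep x a  ("the tuple x ∈ B^dim represents a"), which is the graph of
-- the composite  D → D/E → A  of the quotient map with the bijection
-- D/E ≅ A.  D = {x | ∃ a. Rep x a} and E = {(x,y) | ∃ a. Rep x a × Rep y a}.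

module _ {LA LB : Language} {A : Structure LA} {B : Structure LB} where
  ImageUnder : ∀ {d n} → (Vec (Carrier B) d → Carrier A → Set) →
               (Vec (Carrier A) n → Set) → Vec (Carrier B) (n * d) → Set
  ImageUnder {d} {n} Rep X z =
    Σ (Vec (Vec (Carrier B) d) n) λ xs → Σ (Vec (Carrier A) n) λ as →
      (z ≡ concat xs) × Pointwise Rep xs as × X as

record Interpretation {LA LB : Language} (A : Structure LA) (B : Structure LB) : Set₁ where
  field
    dim           : ℕ
    Rep           : Vec (Carrier B) dim → Carrier A → Set
    Rep-functional : ∀ {x a a'} → Rep x a → Rep x a' → a ≡ a'
    Rep-onto      : ∀ a → Σ (Vec (Carrier B) dim) λ x → Rep x a
    dom-definable : Definable B (λ x → Σ (Carrier A) λ a → Rep x a)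
    eqv-definable : Definable₂ B (λ x y → Σ (Carrier A) λ a → Rep x a × Rep y a)
    image-definable : ∀ {n} (X : Vec (Carrier A) n → Set) →
                      Definable A X → Definable B (ImageUnder {A = A} {B = B} Rep X)
open Interpretation public

-- a definition: the equivalence relation is trivial (equality on D)
IsDefinition : ∀ {LA LB} {A : Structure LA} {B : Structure LB} →
               Interpretation A B → Set
IsDefinition I = ∀ {x y a} → Rep I x a → Rep I y a → x ≡ y

CompRep : ∀ {LA LB LC} {A : Structure LA} {B : Structure LB} {C : Structure LC} →
          (I : Interpretation A B) (J : Interpretation B C) →
          Vec (Carrier C) (dim I * dim J) → Carrier A → Set
CompRep {B = B} {C = C} I J z a =
  Σ (Vec (Vec (Carrier C) (dim J)) (dim I)) λ xs → Σ (Vec (Carrier B) (dim I)) λ bs →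
    (z ≡ concat xs) × Pointwise (Rep J) xs bs × Rep I bs a

BiInterpretation : ∀ {LA LB} {A : Structure LA} {B : Structure LB} →
                   Interpretation A B → Interpretation B A → Set
BiInterpretation {A = A} {B = B} f g =
  GraphDefinable A (CompRep f g) × GraphDefinable B (CompRep g f)

Theory : Language → Set₁
Theory L = Formula L 0 → Set

Th : ∀ {L} → Structure L → Theory L
Th M φ = Sat M φ []

_⊨_ : ∀ {L} → Structure L → Theory L → Set
M ⊨ T = ∀ φ → T φ → Sat M φ []

SameTheory : ∀ {L} → Structure L → Structure L → Set
SameTheory M N = ∀ φ → (Sat M φ [] → Sat N φ []) × (Sat N φ [] → Sat M φ [])

DefinablyIsomorphic : ∀ {L} {B B' : Structure L} → Interpretation B' B → Set
DefinablyIsomorphic {B = B} {B' = B'} I =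
  Σ (Iso B B') λ h → GraphDefinable B (λ z b → Rep I z (to h b))

SelfRecollecting : ∀ {L} → Theory L → Set₁
SelfRecollecting {L} T =
  (B B' : Structure L) → B ⊨ T → B' ⊨ T →
  (I : Interpretation B' B) → DefinablyIsomorphic I

SelfRecollectingForDefinitions : ∀ {L} → Theory L → Set₁
SelfRecollectingForDefinitions {L} T =
  (B B' : Structure L) → B ⊨ T → B' ⊨ T →
  (I : Interpretation B' B) → IsDefinition I → DefinablyIsomorphic I

Conclusion : ∀ {LA LB} {A₁ A₂ : Structure LA} {B₁ B₂ : Structure LB} →
             Interpretation A₁ B₁ → Interpretation A₂ B₂ → Iso A₁ A₂ → Set₁
Conclusion {A₁ = A₁} {B₁ = B₁} {B₂ = B₂} f α σ =
  Σ (Iso B₁ B₂) λ σ' →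
  Σ (Vec (Carrier B₂) (dim f) → Vec (Carrier B₂) (dim α) → Set) λ Θ →
    Definable₂ B₂ Θ ×
    (∀ (x : Vec (Carrier B₁) (dim f)) (y : Vec (Carrier B₂) (dim α)) (a : Carrier A₁) →
       Rep f x a →
       (Θ (map (to σ') x) y → Rep α y (to σ a)) × (Rep α y (to σ a) → Θ (map (to σ') x) y))

-- Composing g, σ and α interprets B₁ in B₂.  As B₂ is a model of the self-recollecting
-- theory Th B₁, this copy of B₁ is B₂-definably isomorphic to B₂ via some h : B₂ ≅ B₁, and
-- σ′ := h⁻¹.  θ relates a tuple x of B₂ to the α-code of σ a, where a is the element of A₁
-- f-coded by h x.  It is B₂-definable: the definable graph of h sends x to codes of h x, i.e.
-- α-codes of σ-images of g-codes of h x, and since g ∘ f is A₁-definable, its image under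
-- α ∘ σ relates these codes definably to the α-code of σ a.  Composites of definitions are
-- definitions, which covers the case of self-recollection for definitions.

module Submission where

open import Defs
open import Data.Fin using (Fin; zero; suc)
open import Data.Nat using (ℕ; zero; suc; _+_; _*_)
open import Data.Product using (Σ; _×_; _,_; proj₁; proj₂; uncurry)
open import Data.Sum using (_⊎_; inj₁; inj₂)
open import Data.Vec using (Vec; []; _∷_; _++_; concat; map; take; drop; group; lookup; allFin; head)
open import Data.Vec.Properties
  using (++-injective; take++drop≡id; take-map; drop-map; map-++; map-concat; map-∘; map-cong; map-id;
         lookup-map; map-lookup-allFin)
open import Data.Vec.Relation.Binary.Pointwise.Inductive
  using (Pointwise; []; _∷_; uncons; concat⁺; concat⁻)
open import Relation.Binary.PropositionalEquality

private variable
  A B C : Set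
  P P′ Q Q′ : Set
  d k l m n n′ : ℕ

infix 3 _⇔_
_⇔_ : Set → Set → Set
P ⇔ Q = (P → Q) × (Q → P)

⇔-refl : P ⇔ P
⇔-refl = (λ p → p) , (λ p → p)

⇔-sym : P ⇔ Q → Q ⇔ P
⇔-sym (f , g) = g , f

⇔-trans : P ⇔ Q → Q ⇔ Q′ → P ⇔ Q′
⇔-trans (f , g) (f′ , g′) = (λ p → f′ (f p)) , (λ q → g (g′ q))

≡⇒⇔ : P ≡ Q → P ⇔ Q
≡⇒⇔ refl = ⇔-refl

×-⇔ : P ⇔ P′ → Q ⇔ Q′ → (P × Q) ⇔ (P′ × Q′)
×-⇔ (f , f′) (g , g′) = (λ (p , q) → f p , g q) , (λ (p , q) → f′ p , g′ q)

⊎-⇔ : P ⇔ P′ → Q ⇔ Q′ → (P ⊎ Q) ⇔ (P′ ⊎ Q′)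
⊎-⇔ (f , f′) (g , g′) =
  (λ { (inj₁ p) → inj₁ (f p) ; (inj₂ q) → inj₂ (g q) }) ,
  (λ { (inj₁ p) → inj₁ (f′ p) ; (inj₂ q) → inj₂ (g′ q) })

→-⇔ : P ⇔ P′ → Q ⇔ Q′ → (P → Q) ⇔ (P′ → Q′)
→-⇔ (f , f′) (g , g′) = (λ h p → g (h (f′ p))) , (λ h p → g′ (h (f p)))

Σ-⇔ : {F G : A → Set} → (∀ a → F a ⇔ G a) → Σ A F ⇔ Σ A G
Σ-⇔ e = (λ (a , p) → a , proj₁ (e a) p) , (λ (a , q) → a , proj₂ (e a) q)

Π-⇔ : {F G : A → Set} → (∀ a → F a ⇔ G a) → ((a : A) → F a) ⇔ ((a : A) → G a)
Π-⇔ e = (λ h a → proj₁ (e a) (h a)) , (λ h a → proj₂ (e a) (h a))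

-- Vectors

take-++ : (xs : Vec A m) (ys : Vec A n) → take m (xs ++ ys) ≡ xs
take-++ []       ys = refl
take-++ (x ∷ xs) ys = cong (x ∷_) (take-++ xs ys)

drop-++ : (xs : Vec A m) (ys : Vec A n) → drop m (xs ++ ys) ≡ ys
drop-++ []       ys = refl
drop-++ (x ∷ xs) ys = drop-++ xs ys

concat-injective : (xss yss : Vec (Vec A k) n) → concat xss ≡ concat yss → xss ≡ yss
concat-injective []         []         _  = refl
concat-injective (xs ∷ xss) (ys ∷ yss) eq with ++-injective xs ys eq
... | refl , eq′ = cong (xs ∷_) (concat-injective xss yss eq′)

unconcat : ∀ n k → Vec A (n * k) → Vec (Vec A k) n
unconcat n k v = proj₁ (group n k v)

concat-unconcat : ∀ n k (v : Vec A (n * k)) → concat (unconcat n k v) ≡ v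
concat-unconcat n k v = sym (proj₂ (group n k v))

unconcat-concat : (xss : Vec (Vec A k) n) → unconcat n k (concat xss) ≡ xss
unconcat-concat {k = k} {n} xss = concat-injective _ xss (concat-unconcat n k (concat xss))

unconcat-map : (h : A → B) (n k : ℕ) (v : Vec A (n * k)) →
               unconcat n k (map h v) ≡ map (map h) (unconcat n k v)
unconcat-map h n k v = concat-injective _ _ (begin
  concat (unconcat n k (map h v))       ≡⟨ concat-unconcat n k (map h v) ⟩
  map h v                               ≡⟨ cong (map h) (sym (concat-unconcat n k v)) ⟩
  map h (concat (unconcat n k v))       ≡⟨ map-concat h (unconcat n k v) ⟩
  concat (map (map h) (unconcat n k v)) ∎)
  where open ≡-Reasoning

regroup : ∀ n k l → Vec A (n * (k * l)) → Vec (Vec (Vec A l) k) n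
regroup n k l v = map (unconcat k l) (unconcat n (k * l) v)

flatten : Vec (Vec (Vec A l) k) n → Vec A ((n * k) * l)
flatten xsss = concat (concat xsss)

reshape : ∀ n k l → Vec A (n * (k * l)) → Vec A ((n * k) * l)
reshape n k l v = flatten (regroup n k l v)

concat-map-concat-regroup : ∀ n k l (v : Vec A (n * (k * l))) →
                            concat (map concat (regroup n k l v)) ≡ v
concat-map-concat-regroup {A = A} n k l v = begin
  concat (map concat (map (unconcat k l) ws))
    ≡⟨ cong concat (sym (map-∘ concat (unconcat k l) ws)) ⟩
  concat (map (λ w → concat (unconcat k l w)) ws)
    ≡⟨ cong concat (map-cong (concat-unconcat k l) ws) ⟩
  concat (map (λ w → w) ws)
    ≡⟨ cong concat (map-id ws) ⟩
  concat ws
    ≡⟨ concat-unconcat n (k * l) v ⟩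
  v ∎
  where
  open ≡-Reasoning
  ws : Vec (Vec A (k * l)) n
  ws = unconcat n (k * l) v

regroup-concat : (xsss : Vec (Vec (Vec A l) k) n) →
                 regroup n k l (concat (map concat xsss)) ≡ xsss
regroup-concat {l = l} {k} {n} xsss = begin
  map (unconcat k l) (unconcat n (k * l) (concat (map concat xsss)))
    ≡⟨ cong (map (unconcat k l)) (unconcat-concat (map concat xsss)) ⟩
  map (unconcat k l) (map concat xsss)
    ≡⟨ sym (map-∘ (unconcat k l) concat xsss) ⟩
  map (λ xss → unconcat k l (concat xss)) xsss
    ≡⟨ map-cong unconcat-concat xsss ⟩
  map (λ xss → xss) xsss
    ≡⟨ map-id xsss ⟩
  xsss ∎
  where open ≡-Reasoning

regroup-map : (h : A → B) (n k l : ℕ) (v : Vec A (n * (k * l))) →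
              regroup n k l (map h v) ≡ map (map (map h)) (regroup n k l v)
regroup-map {A = A} h n k l v = begin
  map (unconcat k l) (unconcat n (k * l) (map h v))
    ≡⟨ cong (map (unconcat k l)) (unconcat-map h n (k * l) v) ⟩
  map (unconcat k l) (map (map h) ws)
    ≡⟨ sym (map-∘ (unconcat k l) (map h) ws) ⟩
  map (λ w → unconcat k l (map h w)) ws
    ≡⟨ map-cong (unconcat-map h k l) ws ⟩
  map (λ w → map (map h) (unconcat k l w)) ws
    ≡⟨ map-∘ (map (map h)) (unconcat k l) ws ⟩
  map (map (map h)) (regroup n k l v) ∎
  where
  open ≡-Reasoning
  ws : Vec (Vec A (k * l)) n
  ws = unconcat n (k * l) v

reshape-concat : (xsss : Vec (Vec (Vec A l) k) n) →
                 reshape n k l (concat (map concat xsss)) ≡ flatten xsss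
reshape-concat xsss = cong flatten (regroup-concat xsss)

reshape-map : (h : A → B) (n k l : ℕ) (v : Vec A (n * (k * l))) →
              reshape n k l (map h v) ≡ map h (reshape n k l v)
reshape-map {A = A} h n k l v = begin
  flatten (regroup n k l (map h v))        ≡⟨ cong flatten (regroup-map h n k l v) ⟩
  flatten (map (map (map h)) xsss)         ≡⟨ cong concat (sym (map-concat (map h) xsss)) ⟩
  concat (map (map h) (concat xsss))       ≡⟨ sym (map-concat h (concat xsss)) ⟩
  map h (flatten xsss)                     ∎
  where
  open ≡-Reasoning
  xsss : Vec (Vec (Vec A l) k) n
  xsss = regroup n k l v

module _ {R : A → B → Set} where

  pointwise-functional : (∀ {x a a′} → R x a → R x a′ → a ≡ a′) →
                         {xs : Vec A n} {as as′ : Vec B n} →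
                         Pointwise R xs as → Pointwise R xs as′ → as ≡ as′
  pointwise-functional fun []       []         = refl
  pointwise-functional fun (r ∷ rs) (r′ ∷ rs′) =
    cong₂ _∷_ (fun r r′) (pointwise-functional fun rs rs′)

  pointwise-injective : (∀ {x y a} → R x a → R y a → x ≡ y) →
                        {xs ys : Vec A n} {as : Vec B n} →
                        Pointwise R xs as → Pointwise R ys as → xs ≡ ys
  pointwise-injective inj []       []         = refl
  pointwise-injective inj (r ∷ rs) (r′ ∷ rs′) =
    cong₂ _∷_ (inj r r′) (pointwise-injective inj rs rs′)

  pointwise-map : (code : B → A) → (∀ a → R (code a) a) →
                  (as : Vec B n) → Pointwise R (map code as) as
  pointwise-map code r []       = []
  pointwise-map code r (a ∷ as) = r a ∷ pointwise-map code r as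

  pointwise-∘ : (t : C → B) {xs : Vec A n} {cs : Vec C n} →
                Pointwise (λ x c → R x (t c)) xs cs ⇔ Pointwise R xs (map t cs)
  pointwise-∘ t {cs = []}     = (λ { [] → [] }) , (λ { [] → [] })
  pointwise-∘ t {cs = c ∷ cs} =
    (λ { (r ∷ rs) → r ∷ proj₁ (pointwise-∘ t) rs }) ,
    (λ { (r ∷ rs) → r ∷ proj₂ (pointwise-∘ t) rs })

record Rearrangement (m n : ℕ) : Set₁ where
  field
    rearrange     : ∀ {A : Set} → Vec A m → Vec A n
    rearrange-map : ∀ {A B : Set} (h : A → B) (v : Vec A m) →
                    rearrange (map h v) ≡ map h (rearrange v)
open Rearrangement public

idᴿ : Rearrangement n n
idᴿ = record { rearrange = λ v → v ; rearrange-map = λ h v → refl }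

infixr 9 _∘ᴿ_
infixr 5 _++ᴿ_

_∘ᴿ_ : Rearrangement m n → Rearrangement k m → Rearrangement k n
ρ ∘ᴿ τ = record
  { rearrange     = λ v → rearrange ρ (rearrange τ v)
  ; rearrange-map = λ h v → trans (cong (rearrange ρ) (rearrange-map τ h v))
                                  (rearrange-map ρ h (rearrange τ v)) }

_++ᴿ_ : Rearrangement k m → Rearrangement k n → Rearrangement k (m + n)
ρ ++ᴿ τ = record
  { rearrange     = λ v → rearrange ρ v ++ rearrange τ v
  ; rearrange-map = λ h v → trans (cong₂ _++_ (rearrange-map ρ h v) (rearrange-map τ h v))
                                  (sym (map-++ h (rearrange ρ v) (rearrange τ v))) }

[]ᴿ : Rearrangement k 0
[]ᴿ = record { rearrange = λ _ → [] ; rearrange-map = λ h v → refl }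

takeᴿ : ∀ m {n} → Rearrangement (m + n) m
takeᴿ m = record { rearrange = take m ; rearrange-map = λ h v → take-map h m v }

dropᴿ : ∀ m {n} → Rearrangement (m + n) n
dropᴿ m = record { rearrange = drop m ; rearrange-map = λ h v → drop-map h m v }

reshapeᴿ : ∀ n k l → Rearrangement (n * (k * l)) ((n * k) * l)
reshapeᴿ n k l = record { rearrange = reshape n k l ; rearrange-map = λ h → reshape-map h n k l }

-- Renaming variables

lift : ∀ {n n′} → (Fin n → Fin n′) → Fin (suc n) → Fin (suc n′)
lift ρ zero    = zero
lift ρ (suc i) = suc (ρ i)

module _ {L : Language} where

  mutual
    renameTerm : ∀ {n n′} → (Fin n → Fin n′) → Term L n → Term L n′
    renameTerm ρ (var i)    = var (ρ i)
    renameTerm ρ (app F ts) = app F (renameTerms ρ ts)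

    renameTerms : ∀ {n n′ k} → (Fin n → Fin n′) → Vec (Term L n) k → Vec (Term L n′) k
    renameTerms ρ []       = []
    renameTerms ρ (t ∷ ts) = renameTerm ρ t ∷ renameTerms ρ ts

  rename : ∀ {n n′} → (Fin n → Fin n′) → Formula L n → Formula L n′
  rename ρ ⊥ᶠ         = ⊥ᶠ
  rename ρ (s ≐ t)    = renameTerm ρ s ≐ renameTerm ρ t
  rename ρ (rel R ts) = rel R (renameTerms ρ ts)
  rename ρ (φ ∧ᶠ ψ)   = rename ρ φ ∧ᶠ rename ρ ψ
  rename ρ (φ ∨ᶠ ψ)   = rename ρ φ ∨ᶠ rename ρ ψ
  rename ρ (φ ⇒ᶠ ψ)   = rename ρ φ ⇒ᶠ rename ρ ψ
  rename ρ (∃ᶠ φ)     = ∃ᶠ (rename (lift ρ) φ)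
  rename ρ (∀ᶠ φ)     = ∀ᶠ (rename (lift ρ) φ)

  -- A natural map Vec _ m → Vec _ n is determined by its value on allFin m,
  -- which is the variable renaming realising it on formulas.
  rearrangeFormula : ∀ {m n} → Rearrangement m n → Formula L n → Formula L m
  rearrangeFormula {m} ρ = rename (lookup (rearrange ρ (allFin m)))

  ⊤ᶠ : ∀ {n} → Formula L n
  ⊤ᶠ = ⊥ᶠ ⇒ᶠ ⊥ᶠ

  ∃* : ∀ k {n} → Formula L (k + n) → Formula L n
  ∃* zero    φ = φ
  ∃* (suc k) φ = ∃* k (∃ᶠ φ)

module _ {L : Language} (M : Structure L) where

  Renames : ∀ {n n′} → (Fin n → Fin n′) → Vec (Carrier M) n → Vec (Carrier M) n′ → Set
  Renames ρ u v = ∀ i → lookup u i ≡ lookup v (ρ i)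

  mutual
    evalT-rename : ∀ {n n′} {ρ : Fin n → Fin n′} {u v} → Renames ρ u v →
                   ∀ t → evalT M (renameTerm ρ t) v ≡ evalT M t u
    evalT-rename r (var i)    = sym (r i)
    evalT-rename r (app F ts) = cong (funᴹ M F) (evalTs-rename r ts)

    evalTs-rename : ∀ {n n′ k} {ρ : Fin n → Fin n′} {u v} → Renames ρ u v →
                    ∀ (ts : Vec (Term L n) k) → evalTs M (renameTerms ρ ts) v ≡ evalTs M ts u
    evalTs-rename r []       = refl
    evalTs-rename r (t ∷ ts) = cong₂ _∷_ (evalT-rename r t) (evalTs-rename r ts)

  Renames-lift : ∀ {n n′} {ρ : Fin n → Fin n′} {u v} → Renames ρ u v →
                 ∀ a → Renames (lift ρ) (a ∷ u) (a ∷ v)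
  Renames-lift r a zero    = refl
  Renames-lift r a (suc i) = r i

  Sat-rename : ∀ {n n′} {ρ : Fin n → Fin n′} {u v} → Renames ρ u v →
               ∀ φ → Sat M (rename ρ φ) v ⇔ Sat M φ u
  Sat-rename r ⊥ᶠ         = ⇔-refl
  Sat-rename r (s ≐ t)    =
    (λ e → trans (sym (evalT-rename r s)) (trans e (evalT-rename r t))) ,
    (λ e → trans (evalT-rename r s) (trans e (sym (evalT-rename r t))))
  Sat-rename r (rel R ts) =
    subst (relᴹ M R) (evalTs-rename r ts) , subst (relᴹ M R) (sym (evalTs-rename r ts))
  Sat-rename r (φ ∧ᶠ ψ)   = ×-⇔ (Sat-rename r φ) (Sat-rename r ψ)
  Sat-rename r (φ ∨ᶠ ψ)   = ⊎-⇔ (Sat-rename r φ) (Sat-rename r ψ)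
  Sat-rename r (φ ⇒ᶠ ψ)   = →-⇔ (Sat-rename r φ) (Sat-rename r ψ)
  Sat-rename r (∃ᶠ φ)     = Σ-⇔ λ a → Sat-rename (Renames-lift r a) φ
  Sat-rename r (∀ᶠ φ)     = Π-⇔ λ a → Sat-rename (Renames-lift r a) φ

  Sat-rearrange : ∀ {m n} (ρ : Rearrangement m n) φ (v : Vec (Carrier M) m) →
                  Sat M (rearrangeFormula ρ φ) v ⇔ Sat M φ (rearrange ρ v)
  Sat-rearrange {m} ρ φ v = Sat-rename renames φ
    where
    renames : Renames (lookup (rearrange ρ (allFin m))) (rearrange ρ v) v
    renames i = begin
      lookup (rearrange ρ v) i
        ≡⟨ cong (λ w → lookup (rearrange ρ w) i) (sym (map-lookup-allFin v)) ⟩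
      lookup (rearrange ρ (map (lookup v) (allFin m))) i
        ≡⟨ cong (λ w → lookup w i) (rearrange-map ρ (lookup v) (allFin m)) ⟩
      lookup (map (lookup v) (rearrange ρ (allFin m))) i
        ≡⟨ lookup-map i (lookup v) (rearrange ρ (allFin m)) ⟩
      lookup v (lookup (rearrange ρ (allFin m)) i) ∎
      where open ≡-Reasoning

  Sat-∃* : ∀ k {n} (φ : Formula L (k + n)) (v : Vec (Carrier M) n) →
           Sat M (∃* k φ) v ⇔ Σ (Vec (Carrier M) k) λ w → Sat M φ (w ++ v)
  Sat-∃* zero    φ v = (λ p → [] , p) , λ { ([] , p) → p }
  Sat-∃* (suc k) φ v =
    (λ p → let w , a , q = proj₁ (Sat-∃* k (∃ᶠ φ) v) p in a ∷ w , q) ,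
    (λ { (a ∷ w , q) → proj₂ (Sat-∃* k (∃ᶠ φ) v) (w , a , q) })

-- Isomorphisms

module _ {L : Language} {M N : Structure L} (σ : Iso M N) where

  to-injective : ∀ {x y} → to σ x ≡ to σ y → x ≡ y
  to-injective {x} {y} e = trans (sym (from∘to σ x)) (trans (cong (from σ) e) (from∘to σ y))

  map-to∘from : (ys : Vec (Carrier N) n) → map (to σ) (map (from σ) ys) ≡ ys
  map-to∘from []       = refl
  map-to∘from (y ∷ ys) = cong₂ _∷_ (to∘from σ y) (map-to∘from ys)

  map-from∘to : (xs : Vec (Carrier M) n) → map (from σ) (map (to σ) xs) ≡ xs
  map-from∘to []       = refl
  map-from∘to (x ∷ xs) = cong₂ _∷_ (from∘to σ x) (map-from∘to xs)

  mutual
    evalT-iso : ∀ (u : Vec (Carrier M) n) t → to σ (evalT M t u) ≡ evalT N t (map (to σ) u)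
    evalT-iso u (var i)    = sym (lookup-map i (to σ) u)
    evalT-iso u (app F ts) =
      trans (fun-pres σ F (evalTs M ts u)) (cong (funᴹ N F) (evalTs-iso u ts))

    evalTs-iso : ∀ (u : Vec (Carrier M) n) (ts : Vec (Term L n) k) →
                 map (to σ) (evalTs M ts u) ≡ evalTs N ts (map (to σ) u)
    evalTs-iso u []       = refl
    evalTs-iso u (t ∷ ts) = cong₂ _∷_ (evalT-iso u t) (evalTs-iso u ts)

  private
    Sat-at : Formula L (suc n) → Vec (Carrier M) n → Carrier N → Set
    Sat-at φ u b = Sat N φ (b ∷ map (to σ) u)

  Sat-iso : ∀ φ (u : Vec (Carrier M) n) → Sat M φ u ⇔ Sat N φ (map (to σ) u)
  Sat-iso ⊥ᶠ         u = ⇔-refl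
  Sat-iso (s ≐ t)    u =
    (λ e → trans (sym (evalT-iso u s)) (trans (cong (to σ) e) (evalT-iso u t))) ,
    (λ e → to-injective (trans (evalT-iso u s) (trans e (sym (evalT-iso u t)))))
  Sat-iso (rel R ts) u =
    (λ r → subst (relᴹ N R) (evalTs-iso u ts) (proj₁ (rel-pres σ R (evalTs M ts u)) r)) ,
    (λ r → proj₂ (rel-pres σ R (evalTs M ts u)) (subst (relᴹ N R) (sym (evalTs-iso u ts)) r))
  Sat-iso (φ ∧ᶠ ψ)   u = ×-⇔ (Sat-iso φ u) (Sat-iso ψ u)
  Sat-iso (φ ∨ᶠ ψ)   u = ⊎-⇔ (Sat-iso φ u) (Sat-iso ψ u)
  Sat-iso (φ ⇒ᶠ ψ)   u = →-⇔ (Sat-iso φ u) (Sat-iso ψ u)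
  Sat-iso (∃ᶠ φ)     u =
    (λ (a , p) → to σ a , proj₁ (Sat-iso φ (a ∷ u)) p) ,
    (λ (b , q) → from σ b ,
       proj₂ (Sat-iso φ (from σ b ∷ u)) (subst (Sat-at φ u) (sym (to∘from σ b)) q))
  Sat-iso (∀ᶠ φ)     u =
    (λ p b → subst (Sat-at φ u) (to∘from σ b)
                   (proj₁ (Sat-iso φ (from σ b ∷ u)) (p (from σ b)))) ,
    (λ q a → proj₂ (Sat-iso φ (a ∷ u)) (q (to σ a)))

Iso-sym : ∀ {L} {M N : Structure L} → Iso M N → Iso N M
Iso-sym {M = M} {N} σ = record
  { to       = from σ
  ; from     = to σ
  ; from∘to  = to∘from σ
  ; to∘from  = from∘to σ
  ; fun-pres = λ F ys → to-injective σ (begin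
      to σ (from σ (funᴹ N F ys))            ≡⟨ to∘from σ _ ⟩
      funᴹ N F ys                            ≡⟨ cong (funᴹ N F) (sym (map-to∘from σ ys)) ⟩
      funᴹ N F (map (to σ) (map (from σ) ys)) ≡⟨ sym (fun-pres σ F (map (from σ) ys)) ⟩
      to σ (funᴹ M F (map (from σ) ys))      ∎)
  ; rel-pres = λ R ys → ⇔-sym (⇔-trans (rel-pres σ R (map (from σ) ys))
                                       (≡⇒⇔ (cong (relᴹ N R) (map-to∘from σ ys)))) }
  where open ≡-Reasoning

-- Definable sets

Related : (Vec A n → Vec A m → Set) → Vec A (n + m) → Set
Related {A = A} {n} {m} R z = Σ (Vec A n) λ x → Σ (Vec A m) λ y → (z ≡ x ++ y) × R x y

module _ {R : Vec A n → Vec A m → Set} where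

  Related-++ : (x : Vec A n) (y : Vec A m) → Related R (x ++ y) ⇔ R x y
  Related-++ x y = (λ { (x′ , y′ , e , r) → subst₂ R (sym (proj₁ (++-injective x x′ e)))
                                                    (sym (proj₂ (++-injective x x′ e))) r }) ,
                   (λ r → x , y , refl , r)

  Related-≡ : {z : Vec A (n + m)} {x : Vec A n} {y : Vec A m} →
              z ≡ x ++ y → Related R z ⇔ R x y
  Related-≡ {x = x} {y} refl = Related-++ x y

  Related-split : (z : Vec A (n + m)) → Related R z ⇔ R (take n z) (drop n z)
  Related-split z = Related-≡ (sym (take++drop≡id n z))

module _ {L : Language} (M : Structure L) where

  definable-cong : {X Y : Vec (Carrier M) n → Set} →
                   Definable M X → (∀ x → X x ⇔ Y x) → Definable M Y
  definable-cong (m , φ , b , d) e = m , φ , b , λ x → ⇔-trans (⇔-sym (e x)) (d x)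

  definable-Sat : (φ : Formula L (n + 0)) → Definable M (λ x → Sat M φ (x ++ []))
  definable-Sat φ = 0 , φ , [] , λ x → ⇔-refl

  private
    Sat-rearrange-≡ : (ρ : Rearrangement m n) (φ : Formula L n)
                      {v : Vec (Carrier M) m} {w : Vec (Carrier M) n} →
                      rearrange ρ v ≡ w → Sat M (rearrangeFormula ρ φ) v ⇔ Sat M φ w
    Sat-rearrange-≡ ρ φ refl = Sat-rearrange M ρ φ _

  definable-preimage : (ρ : Rearrangement n′ n) {X : Vec (Carrier M) n → Set} → Definable M X →
                       Definable M (λ x → X (rearrange ρ x))
  definable-preimage {n′} ρ (m , φ , b , d) =
    m , rearrangeFormula ρ′ φ , b , λ x →
      ⇔-trans (d (rearrange ρ x)) (⇔-sym (Sat-rearrange-≡ ρ′ φ (ρ′-++ x)))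
    where
    ρ′ : Rearrangement (n′ + m) (_ + m)
    ρ′ = (ρ ∘ᴿ takeᴿ n′) ++ᴿ dropᴿ n′
    ρ′-++ : ∀ x → rearrange ρ′ (x ++ b) ≡ rearrange ρ x ++ b
    ρ′-++ x = cong₂ _++_ (cong (rearrange ρ) (take-++ x b)) (drop-++ x b)

  definable-∧ : {X Y : Vec (Carrier M) n → Set} → Definable M X → Definable M Y →
                Definable M (λ x → X x × Y x)
  definable-∧ {n} (m₁ , φ₁ , b₁ , d₁) (m₂ , φ₂ , b₂ , d₂) =
    m₁ + m₂ , rearrangeFormula ρ₁ φ₁ ∧ᶠ rearrangeFormula ρ₂ φ₂ , b₁ ++ b₂ , λ x →
      ⇔-trans (×-⇔ (d₁ x) (d₂ x))
              (⇔-sym (×-⇔ (Sat-rearrange-≡ ρ₁ φ₁ (ρ₁-++ x))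
                          (Sat-rearrange-≡ ρ₂ φ₂ (ρ₂-++ x))))
    where
    ρ₁ : Rearrangement (n + (m₁ + m₂)) (n + m₁)
    ρ₁ = takeᴿ n ++ᴿ (takeᴿ m₁ ∘ᴿ dropᴿ n)
    ρ₂ : Rearrangement (n + (m₁ + m₂)) (n + m₂)
    ρ₂ = takeᴿ n ++ᴿ (dropᴿ m₁ ∘ᴿ dropᴿ n)
    ρ₁-++ : ∀ x → rearrange ρ₁ (x ++ (b₁ ++ b₂)) ≡ x ++ b₁
    ρ₁-++ x = cong₂ _++_ (take-++ x (b₁ ++ b₂))
                         (trans (cong (take m₁) (drop-++ x (b₁ ++ b₂))) (take-++ b₁ b₂))
    ρ₂-++ : ∀ x → rearrange ρ₂ (x ++ (b₁ ++ b₂)) ≡ x ++ b₂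
    ρ₂-++ x = cong₂ _++_ (take-++ x (b₁ ++ b₂))
                         (trans (cong (drop m₁) (drop-++ x (b₁ ++ b₂))) (drop-++ b₁ b₂))

  definable-∃ : {X : Vec (Carrier M) (n + k) → Set} → Definable M X →
                Definable M (λ x → Σ (Vec (Carrier M) k) λ w → X (x ++ w))
  definable-∃ {n} {k} (m , φ , b , d) =
    m , ∃* k (rearrangeFormula ρ φ) , b , λ x →
      ⇔-trans (Σ-⇔ λ w → ⇔-trans (d (x ++ w)) (⇔-sym (Sat-rearrange-≡ ρ φ (ρ-++ w x))))
              (⇔-sym (Sat-∃* M k (rearrangeFormula ρ φ) (x ++ b)))
    where
    ρ : Rearrangement (k + (n + m)) ((n + k) + m)
    ρ = ((takeᴿ n ∘ᴿ dropᴿ k) ++ᴿ takeᴿ k) ++ᴿ (dropᴿ n ∘ᴿ dropᴿ k)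
    ρ-++ : ∀ w x → rearrange ρ (w ++ (x ++ b)) ≡ (x ++ w) ++ b
    ρ-++ w x = cong₂ _++_
      (cong₂ _++_ (trans (cong (take n) (drop-++ w (x ++ b))) (take-++ x b)) (take-++ w (x ++ b)))
      (trans (cong (drop n) (drop-++ w (x ++ b))) (drop-++ x b))

module _ {L : Language} {M N : Structure L} (σ : Iso M N) where

  definable-transport : {X : Vec (Carrier M) n → Set} → Definable M X →
                        Definable N (λ y → X (map (from σ) y))
  definable-transport (m , φ , b , d) = m , φ , map (to σ) b , λ y →
    ⇔-trans (d (map (from σ) y))
            (⇔-trans (Sat-iso σ φ (map (from σ) y ++ b))
                     (≡⇒⇔ (cong (Sat N φ) (transported y))))
    where
    transported : ∀ y → map (to σ) (map (from σ) y ++ b) ≡ y ++ map (to σ) b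
    transported y = trans (map-++ (to σ) (map (from σ) y) b)
                          (cong (_++ map (to σ) b) (map-to∘from σ y))

module _ {L : Language} {M : Structure L} where

  definable₂-cong : {R S : Vec (Carrier M) n → Vec (Carrier M) m → Set} →
                    Definable₂ M R → (∀ x y → R x y ⇔ S x y) → Definable₂ M S
  definable₂-cong dR e = definable-cong M dR λ z →
    (λ (x , y , eq , r) → x , y , eq , proj₁ (e x y) r) ,
    (λ (x , y , eq , s) → x , y , eq , proj₂ (e x y) s)

  definable₂-∘ : {R : Vec (Carrier M) n → Vec (Carrier M) m → Set}
                 {S : Vec (Carrier M) m → Vec (Carrier M) k → Set} →
                 Definable₂ M R → Definable₂ M S →
                 Definable₂ M (λ x z → Σ (Vec (Carrier M) m) λ y → R x y × S y z)
  definable₂-∘ {n} {m} {k} {R} {S} dR dS =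
    definable-cong M
      (definable-∃ M (definable-∧ M (definable-preimage M ρ₁ dR) (definable-preimage M ρ₂ dS)))
      composed
    where
    ρ₁ : Rearrangement ((n + k) + m) (n + m)
    ρ₁ = (takeᴿ n ∘ᴿ takeᴿ (n + k)) ++ᴿ dropᴿ (n + k)
    ρ₂ : Rearrangement ((n + k) + m) (m + k)
    ρ₂ = dropᴿ (n + k) ++ᴿ (dropᴿ n ∘ᴿ takeᴿ (n + k))
    composed : ∀ w → (Σ (Vec (Carrier M) m) λ y →
                         Related R (rearrange ρ₁ (w ++ y)) × Related S (rearrange ρ₂ (w ++ y)))
                     ⇔ Related (λ x z → Σ (Vec (Carrier M) m) λ y → R x y × S y z) w
    composed w = ⇔-trans (Σ-⇔ λ y → ×-⇔ (Related-≡ (ρ₁-++ y)) (Related-≡ (ρ₂-++ y)))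
                         (⇔-sym (Related-split w))
      where
      ρ₁-++ : ∀ y → rearrange ρ₁ (w ++ y) ≡ take n w ++ y
      ρ₁-++ y = cong₂ _++_ (cong (take n) (take-++ w y)) (drop-++ w y)
      ρ₂-++ : ∀ y → rearrange ρ₂ (w ++ y) ≡ y ++ drop n w
      ρ₂-++ y = cong₂ _++_ (drop-++ w y) (cong (drop n) (take-++ w y))

  definable₂-pointwise : {R : Vec (Carrier M) k → Carrier M → Set} → GraphDefinable M R → ∀ n →
                         Definable₂ M {n} {n * k} (λ x v → Pointwise R (unconcat n k v) x)
  definable₂-pointwise _ zero =
    definable-cong M (definable-Sat M ⊤ᶠ) λ { [] → (λ _ → [] , [] , refl , []) , (λ _ ()) }
  definable₂-pointwise {k} dR (suc n) =
    definable-cong M (definable-∧ M (definable-preimage M ρ₁ dR)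
                                    (definable-preimage M ρ₂ (definable₂-pointwise dR n)))
      λ { (b ∷ s) → ⇔-trans (×-⇔ (Related-++ (b ∷ []) _) (Related-++ _ _))
                            (⇔-sym (⇔-trans (Related-split (b ∷ s)) (uncons , uncurry _∷_))) }
    where
    ρ₁ : Rearrangement (1 + (n + (k + n * k))) (1 + k)
    ρ₁ = takeᴿ 1 ++ᴿ takeᴿ k ∘ᴿ dropᴿ n ∘ᴿ dropᴿ 1
    ρ₂ : Rearrangement (1 + (n + (k + n * k))) (n + n * k)
    ρ₂ = takeᴿ n ∘ᴿ dropᴿ 1 ++ᴿ dropᴿ k ∘ᴿ dropᴿ n ∘ᴿ dropᴿ 1

-- Interpretations

-- ImageUnder and CompRep of Defs, restated over bare carriers; they are definitionally equal.
Image : (Vec B d → A → Set) → (Vec A n → Set) → Vec B (n * d) → Set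
Image {B = B} {d} {A} {n} R X z =
  Σ (Vec (Vec B d) n) λ xs → Σ (Vec A n) λ as → (z ≡ concat xs) × Pointwise R xs as × X as

compRep : (Vec B k → A → Set) → (Vec C l → B → Set) → Vec C (k * l) → A → Set
compRep R S z a = Image S (λ bs → R bs a) z

Image-concat : {R : Vec B d → A → Set} {X : Vec A n → Set} (xs : Vec (Vec B d) n) →
               Image R X (concat xs) ⇔ Σ (Vec A n) λ as → Pointwise R xs as × X as
Image-concat {R = R} xs =
  (λ (xs′ , as , e , p , x) →
     as , subst (λ ys → Pointwise R ys as) (sym (concat-injective xs xs′ e)) p , x) ,
  (λ (as , p , x) → xs , as , refl , p , x)

module _ {R : Vec B k → A → Set} {S : Vec C l → B → Set} where

  pointwise-compRep⁻ : {zs : Vec (Vec C (k * l)) n} {as : Vec A n} → Pointwise (compRep R S) zs as →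
                       Σ (Vec (Vec (Vec C l) k) n) λ xss → Σ (Vec (Vec B k) n) λ bss →
                         (zs ≡ map concat xss) × Pointwise (Pointwise S) xss bss × Pointwise R bss as
  pointwise-compRep⁻ [] = [] , [] , refl , [] , []
  pointwise-compRep⁻ ((xs , bs , refl , p , r) ∷ ps) =
    let xss , bss , e , pp , rs = pointwise-compRep⁻ ps
    in xs ∷ xss , bs ∷ bss , cong (concat xs ∷_) e , p ∷ pp , r ∷ rs

  pointwise-compRep⁺ : {xss : Vec (Vec (Vec C l) k) n} {bss : Vec (Vec B k) n} {as : Vec A n} →
                       Pointwise (Pointwise S) xss bss → Pointwise R bss as →
                       Pointwise (compRep R S) (map concat xss) as
  pointwise-compRep⁺ []       []       = []
  pointwise-compRep⁺ (p ∷ pp) (r ∷ rs) = (_ , _ , refl , p , r) ∷ pointwise-compRep⁺ pp rs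

  Image-compRep : {X : Vec A n → Set} (z : Vec C (n * (k * l))) →
                  Image (compRep R S) X z ⇔ Image S (Image R X) (reshape n k l z)
  Image-compRep {n} {X} z = forward , backward
    where
    forward : Image (compRep R S) X z → Image S (Image R X) (reshape n k l z)
    forward (zs , as , refl , ps , x) with pointwise-compRep⁻ ps
    ... | xss , bss , refl , pp , rs =
      concat xss , concat bss , reshape-concat xss , concat⁺ pp , bss , as , refl , rs , x
    backward : Image S (Image R X) (reshape n k l z) → Image (compRep R S) X z
    backward (ys , ws , e , p , bss , as , refl , rs , x) =
      map concat xss , as , sym (concat-map-concat-regroup n k l z) ,
      pointwise-compRep⁺ (concat⁻ xss bss (subst (λ ys → Pointwise S ys (concat bss)) (sym xss≡ys) p))
                         rs ,
      x
      where
      xss : Vec (Vec (Vec C l) k) n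
      xss = regroup n k l z
      xss≡ys : concat xss ≡ ys
      xss≡ys = concat-injective _ ys e

Graph : (Vec A k → A → Set) → Vec A (1 + k) → Set
Graph R = Related (λ a as → R as (head a))

module _ {R : Vec A k → A → Set} {S : Vec C l → A → Set} where

  Image-Graph : (y : Vec C l) (u : Vec C (k * l)) →
                Image S (Graph R) (y ++ u) ⇔ Σ A λ a → S y a × compRep R S u a
  Image-Graph y u = forward , backward
    where
    forward : Image S (Graph R) (y ++ u) → Σ A λ a → S y a × compRep R S u a
    forward (x ∷ xs , a ∷ as , e , s ∷ p , _ ∷ [] , _ , refl , r) with ++-injective y x e
    ... | refl , refl = a , s , xs , as , refl , p , r
    backward : (Σ A λ a → S y a × compRep R S u a) → Image S (Graph R) (y ++ u)
    backward (a , s , xs , as , refl , p , r) =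
      y ∷ xs , a ∷ as , refl , s ∷ p , a ∷ [] , as , refl , r

module _ {LA LB : Language} {A : Structure LA} {B : Structure LB} where

  code : (I : Interpretation A B) → Carrier A → Vec (Carrier B) (dim I)
  code I a = proj₁ (Rep-onto I a)

  code-Rep : (I : Interpretation A B) (a : Carrier A) → Rep I (code I a) a
  code-Rep I a = proj₂ (Rep-onto I a)

  module _ {d : ℕ} (R : Vec (Carrier B) d → Carrier A → Set)
           (image : ∀ {n} (X : Vec (Carrier A) n → Set) →
                    Definable A X → Definable B (Image R X)) where

    domain-definable : Definable B (λ x → Σ (Carrier A) λ a → R x a)
    domain-definable =
      definable-cong B (definable-preimage B (idᴿ ++ᴿ []ᴿ) (image _ (definable-Sat A ⊤ᶠ))) λ x →
        ⇔-trans (Image-concat (x ∷ []))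
                ((λ { (a ∷ [] , r ∷ [] , _) → a , r }) , (λ (a , r) → a ∷ [] , r ∷ [] , λ ()))

    kernel-definable : Definable₂ B (λ x y → Σ (Carrier A) λ a → R x a × R y a)
    kernel-definable =
      definable-cong B (definable-preimage B (takeᴿ d ++ᴿ dropᴿ d ++ᴿ []ᴿ)
                         (image _ (definable-Sat A (var zero ≐ var (suc zero))))) λ z →
        ⇔-trans (Image-concat (take d z ∷ drop d z ∷ []))
                (⇔-trans ((λ { (a ∷ _ ∷ [] , r ∷ r′ ∷ [] , refl) → a , r , r′ }) ,
                          (λ (a , r , r′) → a ∷ a ∷ [] , r ∷ r′ ∷ [] , refl))
                         (⇔-sym (Related-split z)))

  mkInterpretation : (d : ℕ) (R : Vec (Carrier B) d → Carrier A → Set) →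
                     (∀ {x a a′} → R x a → R x a′ → a ≡ a′) →
                     (∀ a → Σ (Vec (Carrier B) d) λ x → R x a) →
                     (∀ {n} (X : Vec (Carrier A) n → Set) →
                      Definable A X → Definable B (Image R X)) →
                     Interpretation A B
  mkInterpretation d R functional onto image = record
    { dim             = d
    ; Rep             = R
    ; Rep-functional  = functional
    ; Rep-onto        = onto
    ; dom-definable   = domain-definable R image
    ; eqv-definable   = kernel-definable R image
    ; image-definable = image }

module _ {LA LB : Language} {A A′ : Structure LA} {B : Structure LB}
         (σ : Iso A A′) (I : Interpretation A′ B) where

  precompose : Interpretation A B
  precompose = mkInterpretation (dim I) (λ x a → Rep I x (to σ a))
    (λ r r′ → to-injective σ (Rep-functional I r r′))
    (λ a → Rep-onto I (to σ a))
    (λ X dX → definable-cong B (image-definable I _ (definable-transport σ dX)) λ z →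
                ⇔-sym (Image-iso z))
    where
    Image-iso : ∀ {n} {X : Vec (Carrier A) n → Set} z →
                Image (λ x a → Rep I x (to σ a)) X z ⇔ Image (Rep I) (λ as → X (map (from σ) as)) z
    Image-iso {X = X} z =
      (λ (xs , as , e , p , x) → xs , map (to σ) as , e , proj₁ (pointwise-∘ (to σ)) p ,
                                 subst X (sym (map-from∘to σ as)) x) ,
      (λ (xs , as , e , p , x) →
         xs , map (from σ) as , e ,
         proj₂ (pointwise-∘ (to σ)) (subst (Pointwise (Rep I) xs) (sym (map-to∘from σ as)) p) , x)

module _ {LA LB LC : Language} {A : Structure LA} {B : Structure LB} {C : Structure LC}
         (I : Interpretation A B) (J : Interpretation B C) where

  compose : Interpretation A C
  compose = mkInterpretation (dim I * dim J) (compRep (Rep I) (Rep J)) functional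
    (λ a → concat (map (code J) (code I a)) , map (code J) (code I a) , code I a , refl ,
           pointwise-map (code J) (code-Rep J) (code I a) , code-Rep I a)
    (λ {n} X dX → definable-cong C (definable-preimage C (reshapeᴿ n (dim I) (dim J))
                                      (image-definable J _ (image-definable I X dX)))
                    λ z → ⇔-sym (Image-compRep z))
    where
    functional : ∀ {z a a′} →
                 compRep (Rep I) (Rep J) z a → compRep (Rep I) (Rep J) z a′ → a ≡ a′
    functional (xs , bs , refl , p , r) (xs′ , bs′ , e , p′ , r′) with concat-injective xs xs′ e
    ... | refl with pointwise-functional (Rep-functional J) p p′
    ... | refl = Rep-functional I r r′

  compose-isDefinition : IsDefinition I → IsDefinition J → IsDefinition compose
  compose-isDefinition defI defJ (xs , bs , refl , p , r) (xs′ , bs′ , refl , p′ , r′)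
    with defI r r′
  ... | refl = cong concat (pointwise-injective defJ p p′)

module _ {LA LC : Language} {A : Structure LA} {C : Structure LC} {B : Set}
         {R : Vec B k → Carrier A → Set} {S : Vec (Carrier A) l → B → Set} where

  recoding-definable : GraphDefinable A (compRep R S) → (J : Interpretation A C) →
                       Definable₂ C (λ v y → Σ (Carrier A) λ a →
                                               compRep R (compRep S (Rep J)) v a × Rep J y a)
  recoding-definable graph J =
    definable-cong C (definable-preimage C ρ (image-definable J _ graph)) λ z →
      ⇔-trans (Image-Graph (drop (k * (l * dim J)) z) (reshape k l (dim J) (take (k * (l * dim J)) z)))
              (⇔-trans (Σ-⇔ λ a → (λ (s , c) → proj₂ (Image-compRep _) c , s) ,
                                  (λ (c , s) → s , proj₁ (Image-compRep _) c))
                       (⇔-sym (Related-split z)))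
    where
    ρ : Rearrangement (k * (l * dim J) + dim J) (dim J + (k * l) * dim J)
    ρ = dropᴿ (k * (l * dim J)) ++ᴿ reshapeᴿ k l (dim J) ∘ᴿ takeᴿ (k * (l * dim J))

module _ {LA LB : Language} {A₁ A₂ : Structure LA} {B₁ B₂ : Structure LB}
         (f : Interpretation A₁ B₁) (α : Interpretation A₂ B₂) (g : Interpretation B₁ A₁)
         (σ : Iso A₁ A₂) where

  transferred : Interpretation B₁ B₂
  transferred = compose g (precompose σ α)

  module _ (h : Iso B₂ B₁) where

    Θ : Vec (Carrier B₂) (dim f) → Vec (Carrier B₂) (dim α) → Set
    Θ x y = Σ (Carrier A₁) λ a → Rep f (map (to h) x) a × Rep α y (to σ a)

    hCode : Carrier B₂ → Vec (Carrier B₂) (dim transferred)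
    hCode b = code transferred (to h b)

    hCode-Rep : (x : Vec (Carrier B₂) n) →
                Pointwise (λ z b → Rep transferred z (to h b)) (map hCode x) x
    hCode-Rep = pointwise-map hCode (λ b → code-Rep transferred (to h b))

    ViaCodes : Vec (Carrier B₂) (dim f) → Vec (Carrier B₂) (dim α) → Set
    ViaCodes x y =
      Σ (Vec (Carrier B₂) (dim f * dim transferred)) λ v →
        Pointwise (λ z b → Rep transferred z (to h b)) (unconcat (dim f) (dim transferred) v) x ×
        Σ (Carrier A₁) λ a → compRep (Rep f) (Rep transferred) v a × Rep α y (to σ a)

    ViaCodes⇔Θ : ∀ x y → ViaCodes x y ⇔ Θ x y
    ViaCodes⇔Θ x y = forward , backward
      where
      forward : ViaCodes x y → Θ x y
      forward (_ , p , a , (zs , bs , refl , q , r) , s) =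
        a , subst (λ bs → Rep f bs a) (pointwise-functional (Rep-functional transferred) q hx) r , s
        where
        hx : Pointwise (Rep transferred) zs (map (to h) x)
        hx = proj₁ (pointwise-∘ (to h)) (subst (λ zs → Pointwise _ zs x) (unconcat-concat zs) p)
      backward : Θ x y → ViaCodes x y
      backward (a , r , s) =
        concat (map hCode x) ,
        subst (λ zs → Pointwise _ zs x) (sym (unconcat-concat (map hCode x))) (hCode-Rep x) ,
        a , (map hCode x , map (to h) x , refl , proj₁ (pointwise-∘ (to h)) (hCode-Rep x) , r) , s

    Θ-map-from : ∀ x y a → Rep f x a → Θ (map (from h) x) y ⇔ Rep α y (to σ a)
    Θ-map-from x y a r rewrite map-to∘from h x =
      (λ (a′ , r′ , s) → subst (λ a → Rep α y (to σ a)) (Rep-functional f r′ r) s) ,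
      (λ s → a , r , s)

  conclusion : GraphDefinable A₁ (CompRep f g) → DefinablyIsomorphic transferred →
               Conclusion f α σ
  conclusion graph-gf (h , graph-h) =
    Iso-sym h , Θ h ,
    definable₂-cong (definable₂-∘ (definable₂-pointwise graph-h (dim f))
                                  (recoding-definable graph-gf (precompose σ α)))
                    (ViaCodes⇔Θ h) ,
    Θ-map-from h

lemma4p7 : ∀ {LA LB : Language} (A₁ A₂ : Structure LA) (B₁ B₂ : Structure LB)
               (f : Interpretation A₁ B₁) (α : Interpretation A₂ B₂)
               (g : Interpretation B₁ A₁) → BiInterpretation f g →
               SameTheory B₁ B₂ →
               (σ : Iso A₁ A₂) →
               (SelfRecollecting (Th B₁) → Conclusion f α σ)
               × (SelfRecollectingForDefinitions (Th B₁) →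
                  IsDefinition f → IsDefinition g → IsDefinition α → Conclusion f α σ)
lemma4p7 A₁ A₂ B₁ B₂ f α g (graph-gf , _) same σ =
  (λ selfRecollecting →
     conclusion f α g σ graph-gf (selfRecollecting B₂ B₁ B₂⊨T B₁⊨T (transferred f α g σ))) ,
  (λ selfRecollecting _ def-g def-α →
     conclusion f α g σ graph-gf
       (selfRecollecting B₂ B₁ B₂⊨T B₁⊨T (transferred f α g σ)
          (compose-isDefinition g (precompose σ α) def-g def-α)))
  where
  B₁⊨T : B₁ ⊨ Th B₁
  B₁⊨T φ p = p
  B₂⊨T : B₂ ⊨ Th B₁
  B₂⊨T φ = proj₁ (same φ)
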